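{- Let $R$ be an integral domain with unit, $p,q\in R$, $U=(U_n)$ with $U_0=0$, $U_1=1$, $U_n=pU_{n-1}-qU_{n-2}$, and $x_n=U_n/U_{n-1}$ for $n\ge2$. Then for all $n\ge2$ (whenever the quotients are defined), $$x_{2n-1}=\frac{x_n^2-q}{2x_n-p},$$ $$x_{3n-2}=x_{n}+\frac{(x_{n}^2-px_{n}+q)(p-2x_{n})}{3x_{n}^2-3px_{n}+p^2-q}.$$ The right-hand sides are respectively one step of the Newton method and one step of the Halley method for $f(t)=t^2-pt+q$ applied to $x_n$; hence these recurrences generate subsequences of $(x_n)$ (e.g. $x_2,x_3,x_5,\dots,x_{2^k+1},\dots$ and $x_2,x_4,x_{10},\dots,x_{3^k+1},\dots$) consisting of the Newton, respectively Halley, approximations of the root of larger modulus of $t^2-pt+q$.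
   Context: Newton's method for $f(t)=0$: $y_{k}=y_{k-1}-f(y_{k-1})/f'(y_{k-1})$, which for $f(t)=t^2-pt+q$ is $y_k=\frac{y_{k-1}^2-q}{2y_{k-1}-p}$. Halley's method: $y_k=y_{k-1}-\frac{2f(y_{k-1})f'(y_{k-1})}{2f'(y_{k-1})^2-f(y_{k-1})f''(y_{k-1})}$, which for $f(t)=t^2-pt+q$ is $y_k=y_{k-1}+\frac{(y_{k-1}^2-py_{k-1}+q)(p-2y_{k-1})}{3y_{k-1}^2-3py_{k-1}+p^2-q}$. -}

module Defs where

open import Level using (Level; _⊔_; suc)
open import Algebra.Bundles using (CommutativeRing)
open import Data.Nat using (ℕ) renaming (zero to zeroℕ; suc to sucℕ)
open import Data.Product using (_×_; _,_; proj₁; proj₂)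
open import Relation.Nullary using (¬_)
import Data.Sum

record IntegralDomain (c ℓ : Level) : Set (suc (c ⊔ ℓ)) where
  field
    commutativeRing : CommutativeRing c ℓ
  open CommutativeRing commutativeRing public
  field
    1≉0           : ¬ (1# ≈ 0#)
    noZeroDivisor : ∀ x y → x * y ≈ 0# → (x ≈ 0#) Data.Sum.⊎ (y ≈ 0#)

module _ {c ℓ : Level} (R : IntegralDomain c ℓ) where
  open IntegralDomain R hiding (zero)

  U : (p q : Carrier) → ℕ → Carrier
  U p q zeroℕ = 0#
  U p q (sucℕ zeroℕ) = 1#
  U p q (sucℕ (sucℕ n)) = p * U p q (sucℕ n) - q * U p q n

  -- Elements of the field of fractions of R, represented as (numerator , denominator).
  Frac : Set c
  Frac = Carrier × Carrier

  num den : Frac → Carrier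
  num = proj₁
  den = proj₂

  ι : Carrier → Frac
  ι r = r , 1#

  infixl 6 _+ᶠ_ _-ᶠ_
  infixl 7 _*ᶠ_ _/ᶠ_
  infix 4 _≈ᶠ_

  _+ᶠ_ : Frac → Frac → Frac
  (a , b) +ᶠ (c , d) = a * d + c * b , b * d

  -ᶠ_ : Frac → Frac
  -ᶠ (a , b) = - a , b

  _-ᶠ_ : Frac → Frac → Frac
  x -ᶠ y = x +ᶠ (-ᶠ y)

  _*ᶠ_ : Frac → Frac → Frac
  (a , b) *ᶠ (c , d) = a * c , b * d

  _/ᶠ_ : Frac → Frac → Frac
  (a , b) /ᶠ (c , d) = a * d , b * c

  _≈ᶠ_ : Frac → Frac → Set ℓ
  (a , b) ≈ᶠ (c , d) = a * d ≈ c * b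

  Defined : Frac → Set ℓ
  Defined x = ¬ (den x ≈ 0#)

  NonZeroᶠ : Frac → Set ℓ
  NonZeroᶠ x = ¬ (num x ≈ 0#)

  two three : Carrier
  two = 1# + 1#
  three = 1# + 1# + 1#

  x : (p q : Carrier) → ℕ → Frac
  x p q zeroℕ = U p q zeroℕ , 0#   -- never used (n ≥ 2 in the theorem)
  x p q (sucℕ n) = U p q (sucℕ n) , U p q n

  newton : (p q : Carrier) → Frac → Frac
  newton p q y = (y *ᶠ y -ᶠ ι q) /ᶠ (ι two *ᶠ y -ᶠ ι p)

  newtonDenom : (p q : Carrier) → Frac → Frac
  newtonDenom p q y = ι two *ᶠ y -ᶠ ι p

  halleyDenom : (p q : Carrier) → Frac → Frac
  halleyDenom p q y = ι three *ᶠ y *ᶠ y -ᶠ ι three *ᶠ ι p *ᶠ y +ᶠ ι p *ᶠ ι p -ᶠ ι q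

  halley : (p q : Carrier) → Frac → Frac
  halley p q y = y +ᶠ ((y *ᶠ y -ᶠ ι p *ᶠ y +ᶠ ι q) *ᶠ (ι p -ᶠ ι two *ᶠ y)) /ᶠ halleyDenom p q y

module Submission where

-- The whole argument rests on the addition formula of the Lucas sequence,
--     U_{m+j+1} = U_{m+1} U_{j+1} - q U_m U_j ,
-- proved by induction on m.  Writing n = m + 1 and a = U_{m+1}, b = U_m, c = U_{m-1}
-- (so that a = p b - q c), it expresses the terms at indices 2m+1, 2m and then
-- 3m+1, 3m through a, b, c, i.e. x_{2n-1} = U_{2m+1}/U_{2m} and
-- x_{3n-2} = U_{3m+1}/U_{3m}.  After cross-multiplication both claimed formulas
-- become polynomial identities in p, q, b, c, valid in every commutative ring;
-- they are discharged by the ring solver.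

open import Defs
open import Level using (Level)
open import Data.Nat using (ℕ; _≤_; _∸_)
open import Data.Product using (_×_)

open import Algebra.Bundles using (CommutativeRing)
open import Data.Nat as ℕ using (zero; suc; s≤s)
import Data.Nat.Properties as ℕP
open import Data.Nat.Tactic.RingSolver using (solve-∀)
open import Data.Product using (_,_; proj₁; proj₂)
open import Data.Integer as ℤ using (ℤ; +_; -[1+_]; _⊖_; sign; ∣_∣; _◃_)
import Data.Integer.Properties as ℤP
open import Data.Sign as Sign using (Sign)
open import Data.Maybe using (Maybe; just; nothing)
open import Relation.Nullary using (yes; no)
open import Relation.Binary.PropositionalEquality as ≡ using (_≡_)
import Algebra.Solver.Ring.AlmostCommutativeRing as ACR

module IntegerCoefficients {c ℓ} (CR : CommutativeRing c ℓ) where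
  open CommutativeRing CR hiding (zero)
  open import Algebra.Properties.Ring ring using (-0#≈0#; -1*x≈-x; -‿involutive; -‿+-comm)
  open import Algebra.Properties.Semiring.Mult.TCOptimised semiring using (1+×; ×-homo-+; ×1-homo-*) renaming (_×_ to _×ₙ_)
  open import Algebra.Properties.CommutativeSemigroup +-commutativeSemigroup using () renaming (interchange to +-interchange)
  open import Algebra.Properties.CommutativeSemigroup *-commutativeSemigroup using () renaming (interchange to *-interchange)
  open import Relation.Binary.Reasoning.Setoid setoid

  -- n ↦ n·1, with 1·1 = 1 definitionally (so the solver's constant 1 is 1#).
  ⟦_⟧ₙ : ℕ → Carrier
  ⟦ n ⟧ₙ = n ×ₙ 1#

  fromℤ : ℤ → Carrier
  fromℤ (+ n)    = ⟦ n ⟧ₙ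
  fromℤ -[1+ n ] = - ⟦ suc n ⟧ₙ

  cancel-1 : ∀ a b → (1# + a) - (1# + b) ≈ a - b
  cancel-1 a b = begin
    (1# + a) - (1# + b)           ≈⟨ +-congˡ (-‿+-comm 1# b) ⟨
    (1# + a) + (- 1# + - b)       ≈⟨ +-interchange 1# a (- 1#) (- b) ⟩
    (1# + - 1#) + (a - b)         ≈⟨ +-congʳ (-‿inverseʳ 1#) ⟩
    0# + (a - b)                  ≈⟨ +-identityˡ _ ⟩
    a - b                         ∎

  fromℤ-⊖ : ∀ m n → fromℤ (m ⊖ n) ≈ ⟦ m ⟧ₙ - ⟦ n ⟧ₙ
  fromℤ-⊖ m zero = begin
    fromℤ (m ⊖ 0) ≡⟨ ≡.cong fromℤ (ℤP.⊖-≥ {m} ℕ.z≤n) ⟩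
    ⟦ m ⟧ₙ        ≈⟨ +-identityʳ _ ⟨
    ⟦ m ⟧ₙ + 0#   ≈⟨ +-congˡ -0#≈0# ⟨
    ⟦ m ⟧ₙ - 0#   ∎
  fromℤ-⊖ zero (suc n) = begin
    fromℤ (0 ⊖ suc n) ≡⟨ ≡.cong fromℤ (ℤP.⊖-< {0} {suc n} (s≤s ℕ.z≤n)) ⟩
    - ⟦ suc n ⟧ₙ      ≈⟨ +-identityˡ _ ⟨
    0# - ⟦ suc n ⟧ₙ   ∎
  fromℤ-⊖ (suc m) (suc n) = begin
    fromℤ (suc m ⊖ suc n)         ≡⟨ ≡.cong fromℤ (ℤP.[1+m]⊖[1+n]≡m⊖n m n) ⟩
    fromℤ (m ⊖ n)                 ≈⟨ fromℤ-⊖ m n ⟩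
    ⟦ m ⟧ₙ - ⟦ n ⟧ₙ               ≈⟨ cancel-1 _ _ ⟨
    (1# + ⟦ m ⟧ₙ) - (1# + ⟦ n ⟧ₙ) ≈⟨ +-cong (1+× m 1#) (-‿cong (1+× n 1#)) ⟨
    ⟦ suc m ⟧ₙ - ⟦ suc n ⟧ₙ       ∎

  fromℤ-+ : ∀ i j → fromℤ (i ℤ.+ j) ≈ fromℤ i + fromℤ j
  fromℤ-+ -[1+ m ] -[1+ n ] = begin
    - ⟦ suc (suc m ℕ.+ n) ⟧ₙ       ≡⟨ ≡.cong (λ k → - ⟦ k ⟧ₙ) (ℕP.+-suc (suc m) n) ⟨
    - ⟦ suc m ℕ.+ suc n ⟧ₙ         ≈⟨ -‿cong (×-homo-+ 1# (suc m) (suc n)) ⟩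
    - (⟦ suc m ⟧ₙ + ⟦ suc n ⟧ₙ)    ≈⟨ -‿+-comm _ _ ⟨
    - ⟦ suc m ⟧ₙ + - ⟦ suc n ⟧ₙ    ∎
  fromℤ-+ -[1+ m ] (+ n)    = trans (fromℤ-⊖ n (suc m)) (+-comm _ _)
  fromℤ-+ (+ m)    -[1+ n ] = fromℤ-⊖ m (suc n)
  fromℤ-+ (+ m)    (+ n)    = ×-homo-+ 1# m n

  fromℤ-neg : ∀ i → fromℤ (ℤ.- i) ≈ - fromℤ i
  fromℤ-neg (+ zero)  = sym -0#≈0#
  fromℤ-neg (+ suc n) = refl
  fromℤ-neg -[1+ n ]  = sym (-‿involutive _)

  -- Multiplication is handled through the sign–magnitude decomposition i = sign i ◃ ∣ i ∣.
  fromSign : Sign → Carrier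
  fromSign Sign.+ = 1#
  fromSign Sign.- = - 1#

  fromSign-* : ∀ s t → fromSign (s Sign.* t) ≈ fromSign s * fromSign t
  fromSign-* Sign.+ t       = sym (*-identityˡ _)
  fromSign-* Sign.- Sign.+  = sym (*-identityʳ _)
  fromSign-* Sign.- Sign.-  = sym (trans (-1*x≈-x (- 1#)) (-‿involutive 1#))

  fromℤ-◃ : ∀ s n → fromℤ (s ◃ n) ≈ fromSign s * ⟦ n ⟧ₙ
  fromℤ-◃ s      zero    = sym (zeroʳ (fromSign s))
  fromℤ-◃ Sign.+ (suc n) = sym (*-identityˡ _)
  fromℤ-◃ Sign.- (suc n) = sym (-1*x≈-x _)

  fromℤ-* : ∀ i j → fromℤ (i ℤ.* j) ≈ fromℤ i * fromℤ j
  fromℤ-* i j = begin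
    fromℤ (sign i Sign.* sign j ◃ ∣ i ∣ ℕ.* ∣ j ∣)     ≈⟨ fromℤ-◃ (sign i Sign.* sign j) (∣ i ∣ ℕ.* ∣ j ∣) ⟩
    fromSign (sign i Sign.* sign j) * ⟦ ∣ i ∣ ℕ.* ∣ j ∣ ⟧ₙ
                                                       ≈⟨ *-cong (fromSign-* (sign i) (sign j)) (×1-homo-* ∣ i ∣ ∣ j ∣) ⟩
    (fromSign (sign i) * fromSign (sign j)) * (⟦ ∣ i ∣ ⟧ₙ * ⟦ ∣ j ∣ ⟧ₙ)
                                                       ≈⟨ *-interchange _ _ _ _ ⟩
    (fromSign (sign i) * ⟦ ∣ i ∣ ⟧ₙ) * (fromSign (sign j) * ⟦ ∣ j ∣ ⟧ₙ)
                                                       ≈⟨ *-cong (fromℤ-◃ (sign i) ∣ i ∣) (fromℤ-◃ (sign j) ∣ j ∣) ⟨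
    fromℤ (sign i ◃ ∣ i ∣) * fromℤ (sign j ◃ ∣ j ∣)    ≡⟨ ≡.cong₂ (λ u v → fromℤ u * fromℤ v) (ℤP.◃-inverse i) (ℤP.◃-inverse j) ⟩
    fromℤ i * fromℤ j                                  ∎

  fromℤ-morphism : ℤ.+-*-rawRing ACR.-Raw-AlmostCommutative⟶ ACR.fromCommutativeRing CR
  fromℤ-morphism = record
    { ⟦_⟧ = fromℤ ; +-homo = fromℤ-+ ; *-homo = fromℤ-* ; -‿homo = fromℤ-neg ; 0-homo = refl ; 1-homo = refl }

  coefficient≟ : ∀ i j → Maybe (fromℤ i ≈ fromℤ j)
  coefficient≟ i j with i ℤ.≟ j
  ... | yes ≡.refl = just refl
  ... | no _       = nothing

  open import Algebra.Solver.Ring ℤ.+-*-rawRing (ACR.fromCommutativeRing CR) fromℤ-morphism coefficient≟ public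

module Fractions {c ℓ} (R : IntegralDomain c ℓ) where
  open IntegralDomain R hiding (zero)
  open IntegerCoefficients commutativeRing using (solve; _:=_; _:+_; _:-_; _:*_; :-_; con; Polynomial)

  ≈ᶠ-by-cross-multiplication : ∀ {a b a′ b′} (y : Frac R) →
    a ≈ a′ → b ≈ b′ → a′ * den R y ≈ num R y * b′ → _≈ᶠ_ R (a , b) y
  ≈ᶠ-by-cross-multiplication y a≈a′ b≈b′ cross =
    trans (*-congʳ a≈a′) (trans cross (*-congˡ (sym b≈b′)))

  -- Syntactic counterparts of the fraction operations of Defs: the solver's
  -- semantics sends each of them to the corresponding operation on Frac R
  -- definitionally, so fraction identities can be handed to the solver.
  module Syntax {n : ℕ} where
    infixl 6 _+ₚ_ _-ₚ_
    infixl 7 _*ₚ_ _/ₚ_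

    Fracₚ : Set
    Fracₚ = Polynomial n × Polynomial n

    oneₚ twoₚ threeₚ : Polynomial n
    oneₚ   = con (+ 1)
    twoₚ   = oneₚ :+ oneₚ
    threeₚ = oneₚ :+ oneₚ :+ oneₚ

    ιₚ : Polynomial n → Fracₚ
    ιₚ r = r , oneₚ

    _+ₚ_ _-ₚ_ _*ₚ_ _/ₚ_ : Fracₚ → Fracₚ → Fracₚ
    (a , b) +ₚ (c , d) = a :* d :+ c :* b , b :* d
    (a , b) -ₚ (c , d) = (a , b) +ₚ (:- c , d)
    (a , b) *ₚ (c , d) = a :* c , b :* d
    (a , b) /ₚ (c , d) = a :* d , b :* c

    newtonₚ halleyDenomₚ halleyₚ : Polynomial n → Polynomial n → Fracₚ → Fracₚ
    newtonₚ p q y = (y *ₚ y -ₚ ιₚ q) /ₚ (ιₚ twoₚ *ₚ y -ₚ ιₚ p)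
    halleyDenomₚ p q y = ιₚ threeₚ *ₚ y *ₚ y -ₚ ιₚ threeₚ *ₚ ιₚ p *ₚ y +ₚ ιₚ p *ₚ ιₚ p -ₚ ιₚ q
    halleyₚ p q y = y +ₚ ((y *ₚ y -ₚ ιₚ p *ₚ y +ₚ ιₚ q) *ₚ (ιₚ p -ₚ ιₚ twoₚ *ₚ y)) /ₚ halleyDenomₚ p q y

  open Syntax

  newton-identity : ∀ p q b c → let a = p * b - q * c in
    (a * a - q * (b * b)) * den R (newton R p q (a , b)) ≈ num R (newton R p q (a , b)) * (b * a - q * (c * b))
  newton-identity = solve 4 (λ p q b c → let a = p :* b :- q :* c in
      (a :* a :- q :* (b :* b)) :* proj₂ (newtonₚ p q (a , b)) := proj₁ (newtonₚ p q (a , b)) :* (b :* a :- q :* (c :* b)))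
    refl

  halley-identity : ∀ p q b c →
    let a  = p * b - q * c
        d₁ = a * a - q * (b * b)
        d₀ = b * a - q * (c * b) in
    (d₁ * a - q * (d₀ * b)) * den R (halley R p q (a , b)) ≈ num R (halley R p q (a , b)) * (d₁ * b - q * (d₀ * c))
  halley-identity = solve 4 (λ p q b c →
      let a  = p :* b :- q :* c
          d₁ = a :* a :- q :* (b :* b)
          d₀ = b :* a :- q :* (c :* b) in
      (d₁ :* a :- q :* (d₀ :* b)) :* proj₂ (halleyₚ p q (a , b)) := proj₁ (halleyₚ p q (a , b)) :* (d₁ :* b :- q :* (d₀ :* c)))
    refl

module LucasSequence {c ℓ} (R : IntegralDomain c ℓ) (p q : IntegralDomain.Carrier R) where
  open IntegralDomain R hiding (zero)
  open IntegerCoefficients commutativeRing using (solve; _:=_; _:-_; _:*_; con)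
  open Fractions R using (≈ᶠ-by-cross-multiplication; newton-identity; halley-identity)

  u : ℕ → Carrier
  u = U R p q

  combination-cong : ∀ {u₁ u₁′ u₀ u₀′ a b} → u₁ ≈ u₁′ → u₀ ≈ u₀′ →
    u₁ * a - q * (u₀ * b) ≈ u₁′ * a - q * (u₀′ * b)
  combination-cong u₁≈ u₀≈ = +-cong (*-congʳ u₁≈) (-‿cong (*-congˡ (*-congʳ u₀≈)))

  U-add : ∀ m j → u (suc (m ℕ.+ j)) ≈ u (suc m) * u (suc j) - q * (u m * u j)
  U-add zero j = solve 3 (λ q s t → s := con (+ 1) :* s :- q :* (con (+ 0) :* t)) refl q (u (suc j)) (u j)
  U-add (suc zero) j = solve 4 (λ p q s t → p :* s :- q :* t := (p :* con (+ 1) :- q :* con (+ 0)) :* s :- q :* (con (+ 1) :* t))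
    refl p q (u (suc j)) (u j)
  U-add (suc (suc m)) j = begin
    p * u (suc (suc m ℕ.+ j)) - q * u (suc (m ℕ.+ j))
      ≈⟨ +-cong (*-congˡ (U-add (suc m) j)) (-‿cong (*-congˡ (U-add m j))) ⟩
    p * (u (suc (suc m)) * u (suc j) - q * (u (suc m) * u j)) - q * (u (suc m) * u (suc j) - q * (u m * u j))
      ≈⟨ solve 6 (λ p q s₁ s₀ t₁ t₀ → let s₂ = p :* s₁ :- q :* s₀ in
             p :* (s₂ :* t₁ :- q :* (s₁ :* t₀)) :- q :* (s₁ :* t₁ :- q :* (s₀ :* t₀))
             := (p :* s₂ :- q :* s₁) :* t₁ :- q :* (s₂ :* t₀))
           refl p q (u (suc m)) (u m) (u (suc j)) (u j) ⟩
    u (suc (suc (suc m))) * u (suc j) - q * (u (suc (suc m)) * u j) ∎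
    where open import Relation.Binary.Reasoning.Setoid setoid

  U-add′ : ∀ m j → u (m ℕ.+ suc j) ≈ u (suc m) * u (suc j) - q * (u m * u j)
  U-add′ m j = ≡.subst (λ k → u k ≈ u (suc m) * u (suc j) - q * (u m * u j)) (≡.sym (ℕP.+-suc m j)) (U-add m j)

  -- With n = m + 1 and m = j + 1: x_{2n-1} = U_{2m+1} / U_{2m} is Newton's step at x_n.
  x-double : ∀ j → let m = suc j in _≈ᶠ_ R (x R p q (suc (m ℕ.+ m))) (newton R p q (x R p q (suc m)))
  x-double j = ≈ᶠ-by-cross-multiplication (newton R p q (x R p q (suc m)))
    (U-add m m) (U-add j m) (newton-identity p q (u m) (u j))
    where
    m : ℕ
    m = suc j

  -- With n = m + 1 and m = j + 1: x_{3n-2} = U_{3m+1} / U_{3m} is Halley's step at x_n.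
  x-triple : ∀ j → let m = suc j in _≈ᶠ_ R (x R p q (suc (m ℕ.+ m ℕ.+ m))) (halley R p q (x R p q (suc m)))
  x-triple j = ≈ᶠ-by-cross-multiplication (halley R p q (x R p q (suc m)))
    (trans (U-add (m ℕ.+ m) m) (combination-cong (U-add m m) (U-add j m)))
    (trans (U-add′ (m ℕ.+ m) j) (combination-cong (U-add m m) (U-add j m)))
    (halley-identity p q (u m) (u j))
    where
    m : ℕ
    m = suc j

-- Natural-number multiplication is opened only here, where it no longer clashes with
-- the ring multiplication of the modules above.
open import Data.Nat using (_*_)

double-index : ∀ m → 2 * suc m ∸ 1 ≡ suc (m ℕ.+ m)
double-index m = ≡.cong (_∸ 1) (twice m)
  where
  twice : ∀ m → 2 * suc m ≡ 2 ℕ.+ (m ℕ.+ m)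
  twice = solve-∀

triple-index : ∀ m → 3 * suc m ∸ 2 ≡ suc (m ℕ.+ m ℕ.+ m)
triple-index m = ≡.cong (_∸ 2) (thrice m)
  where
  thrice : ∀ m → 3 * suc m ≡ 3 ℕ.+ (m ℕ.+ m ℕ.+ m)
  thrice = solve-∀

theorem3p2 : {c ℓ : Level} (R : IntegralDomain c ℓ) (p q : IntegralDomain.Carrier R) (n : ℕ) → 2 ≤ n →
    (Defined R (x R p q n) → Defined R (x R p q (2 * n ∸ 1)) → NonZeroᶠ R (newtonDenom R p q (x R p q n)) →
      _≈ᶠ_ R (x R p q (2 * n ∸ 1)) (newton R p q (x R p q n)))
    × (Defined R (x R p q n) → Defined R (x R p q (3 * n ∸ 2)) → NonZeroᶠ R (halleyDenom R p q (x R p q n)) →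
      _≈ᶠ_ R (x R p q (3 * n ∸ 2)) (halley R p q (x R p q n)))
theorem3p2 R p q (suc (suc j)) (s≤s (s≤s _)) =
    (λ _ _ _ → ≡.subst (λ k → _≈ᶠ_ R (x R p q k) (newton R p q (x R p q n))) (≡.sym (double-index m)) (x-double j))
  , (λ _ _ _ → ≡.subst (λ k → _≈ᶠ_ R (x R p q k) (halley R p q (x R p q n))) (≡.sym (triple-index m)) (x-triple j))
  where
  open LucasSequence R p q using (x-double; x-triple)
  m n : ℕ
  m = suc j
  n = suc m
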